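{- Let $n\ge1$, $d$ a positive divisor of $n$, $C$ the cyclic shift $C(x_0,\dots,x_{n-1})=(x_1,\dots,x_{n-1},x_0)$ on $\mathbb{Z}_2^n$, and for $a\in\mathbb{Z}_n^*$ let $\delta_a$ be the decimation $(\delta_aY)_i=y_{ai\bmod n}$. Let $X=(-1,+1,\dots,+1)$, $A_{i,d}X=\prod_{j=0}^{n/d-1}C^{i+jd}X$ for $0\le i\le d-1$, and $\mathbb{G}_d(n)$ the subgroup generated by $\{A_{0,d}X,\dots,A_{d-1,d}X\}$. Then $\mathbb{G}_d(n)$ is an $S$-subgroup of the Schur ring $\mathfrak{S}(\mathbb{Z}_2^n,\Delta_nC_n)$, i.e. it is a union of orbits of the group generated by $C$ and all $\delta_a$, $a\in\mathbb{Z}_n^*$.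
   Context: $\mathbb{Z}_2^n$ is the group of $\pm1$ sequences of length $n$ under coordinatewise multiplication. $\Delta_n=\{\delta_a:a\in\mathbb{Z}_n^*\}$, $C_n=\langle C\rangle$; $\mathfrak{S}(\mathbb{Z}_2^n,G)$ is the Schur ring whose basic sets are the orbits of the coordinate-permutation group $G$; an $S$-subgroup is a subgroup that is a union of basic sets. -}

module Defs where

open import Data.Bool using (Bool; true; false; _xor_)
open import Data.Nat using (ℕ; zero; suc; _+_; _*_; _<_; _≡ᵇ_; NonZero)
open import Data.Nat.DivMod using (_%_; m%n<n)
open import Data.Nat.Coprimality using (Coprime)
open import Data.Fin using (Fin; toℕ; fromℕ<)
open import Data.Vec using (Vec; tabulate; lookup; zipWith; replicate)
open import Data.List using (List; foldr; map; upTo)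
open import Relation.Binary.Construct.Closure.Equivalence using (EqClosure)

-- Z_2^n : ±1 sequences of length n, encoded as Vec Bool n with
-- true ↔ -1 and false ↔ +1; coordinatewise multiplication is xor.
Z2^ : ℕ → Set
Z2^ n = Vec Bool n

_·_ : ∀ {n} → Z2^ n → Z2^ n → Z2^ n
_·_ = zipWith _xor_

𝟙 : ∀ {n} → Z2^ n
𝟙 = replicate _ false

idx : ∀ n .{{_ : NonZero n}} → ℕ → Fin n
idx n k = fromℕ< (m%n<n k n)

C : ∀ n .{{_ : NonZero n}} → Z2^ n → Z2^ n
C n Y = tabulate λ i → lookup Y (idx n (suc (toℕ i)))

Cpow : ∀ n .{{_ : NonZero n}} → ℕ → Z2^ n → Z2^ n
Cpow n zero Y = Y
Cpow n (suc k) Y = C n (Cpow n k Y)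

δ : ∀ n .{{_ : NonZero n}} → ℕ → Z2^ n → Z2^ n
δ n a Y = tabulate λ i → lookup Y (idx n (a * toℕ i))

X : ∀ n → Z2^ n
X n = tabulate λ i → toℕ i ≡ᵇ 0

-- A_{i,d} X = ∏_{j=0}^{q-1} C^{i + j d} X   where q = n / d
A : ∀ n .{{_ : NonZero n}} → (d q i : ℕ) → Z2^ n
A n d q i = foldr _·_ 𝟙 (map (λ j → Cpow n (i + j * d) (X n)) (upTo q))

data InGen {n : ℕ} (d : ℕ) (gen : ℕ → Z2^ n) : Z2^ n → Set where
  unit : InGen d gen 𝟙
  gen∈ : ∀ i → i < d → InGen d gen (gen i)
  mul  : ∀ {Y Z} → InGen d gen Y → InGen d gen Z → InGen d gen (Y · Z)
  -- inverses: every element of Z_2^n is its own inverse, so closure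
  -- under products already gives the generated subgroup.

data Step (n : ℕ) .{{_ : NonZero n}} : Z2^ n → Z2^ n → Set where
  stepC : ∀ Y → Step n Y (C n Y)
  stepδ : ∀ a → a < n → Coprime a n → ∀ Y → Step n Y (δ n a Y)

-- Y and Z lie in the same orbit (basic set) of the Schur ring
-- 𝔖(Z_2^n, Δ_n C_n): equivalence closure of the generator steps.
SameOrbit : ∀ n .{{_ : NonZero n}} → Z2^ n → Z2^ n → Set
SameOrbit n = EqClosure (Step n)

UnionOfOrbits : ∀ n .{{_ : NonZero n}} → (Z2^ n → Set) → Set
UnionOfOrbits n P = ∀ Y Z → SameOrbit n Y Z → P Y → P Z

𝔾 : ∀ n .{{_ : NonZero n}} → (d q : ℕ) → Z2^ n → Set
𝔾 n d q = InGen d (A n d q)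

-- The generator
-- A_{i,d}X is the indicator of the residue class m ≡ -i (mod d): the n/d shifts of X
-- hit every position of that class exactly once and no other position.  Hence 𝔾_d(n)
-- is exactly the set of d-periodic sequences.  Both C and δ_a act on positions by an
-- affine map m ↦ a m + c, and so do their inverses (for δ_a because a is invertible
-- modulo n); an affine reindexing maps d-periodic sequences to d-periodic ones, as
-- d ∣ n.  So periodicity, and with it membership in 𝔾_d(n), is constant on orbits.
module Submission where

open import Defs
open import Data.Nat using (ℕ; NonZero)
open import Data.Nat.Divisibility using (_∣_; quotient)

open import Data.Bool using (Bool; true; false; _xor_; _∧_; if_then_else_)
open import Data.Bool.Properties
  using (xor-assoc; xor-comm; not-injective; ∧-distribˡ-xor; ∧-zeroʳ; ∧-identityʳ)
open import Data.Nat using (zero; suc; pred; _+_; _*_; _∸_; _<_; _≤_; _≡ᵇ_; z<s; s<s)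
open import Data.Nat.Properties
open import Data.Nat.DivMod
open import Data.Nat.Coprimality using (Coprime; coprime-Bézout)
open import Data.Nat.GCD using (module Bézout)
open import Data.Nat.Tactic.RingSolver using (solve-∀)
open import Data.Fin using (toℕ)
open import Data.Fin.Properties using (toℕ-injective; toℕ-fromℕ<; fromℕ<-cong; toℕ<n)
open import Data.Vec using (lookup; tabulate)
open import Data.Vec.Properties
  using (lookup-zipWith; lookup-replicate; lookup∘tabulate; tabulate∘lookup; tabulate-cong)
open import Data.List using (foldr; map; upTo; applyUpTo)
open import Data.Product using (_×_; _,_; ∃; ∃₂)
open import Function using (_∘_; id; _⇔_; mk⇔; Equivalence)
open import Function.Properties.Equivalence using (⇔-isEquivalence)
open import Relation.Binary.Construct.Closure.Equivalence using (gfold)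
open import Relation.Binary.PropositionalEquality
open ≡-Reasoning
open import Algebra.Properties.CommutativeSemigroup +-commutativeSemigroup
  using (xy∙z≈x∙zy; xy∙z≈xz∙y; xy∙z≈zx∙y)

%-congʳ-+ : ∀ x {y y′ d} .{{_ : NonZero d}} → y % d ≡ y′ % d → (x + y) % d ≡ (x + y′) % d
%-congʳ-+ x {y} {y′} {d} e = begin
  (x + y) % d           ≡⟨ %-distribˡ-+ x y d ⟩
  (x % d + y % d) % d   ≡⟨ cong (λ z → (x % d + z) % d) e ⟩
  (x % d + y′ % d) % d  ≡⟨ %-distribˡ-+ x y′ d ⟨
  (x + y′) % d          ∎

%-congʳ-* : ∀ x {y y′ d} .{{_ : NonZero d}} → y % d ≡ y′ % d → (x * y) % d ≡ (x * y′) % d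
%-congʳ-* x {y} {y′} {d} e = begin
  (x * y) % d             ≡⟨ %-distribˡ-* x y d ⟩
  (x % d * (y % d)) % d   ≡⟨ cong (λ z → (x % d * z) % d) e ⟩
  (x % d * (y′ % d)) % d  ≡⟨ %-distribˡ-* x y′ d ⟨
  (x * y′) % d            ∎

-- In the second Bézout case 1 + x a = y n, so a · x (n - 1) ≡ -x a ≡ 1 (mod n).
modular-inverse : ∀ {a n} .{{_ : NonZero n}} → Coprime a n → ∃ λ b → (a * b) % n ≡ 1 % n
modular-inverse {a} {suc n-1} a⊥n with coprime-Bézout a⊥n
... | Bézout.+- x y 1+yn≡xa = x , (begin
  (a * x) % n      ≡⟨ cong (_% n) (*-comm a x) ⟩
  (x * a) % n      ≡⟨ cong (_% n) 1+yn≡xa ⟨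
  (1 + y * n) % n  ≡⟨ [m+kn]%n≡m%n 1 y n ⟩
  1 % n            ∎)
  where n = suc n-1
... | Bézout.-+ x y 1+xa≡yn = x * n-1 , (begin
  (a * (x * n-1)) % n                ≡⟨ [m+kn]%n≡m%n (a * (x * n-1)) y n ⟨
  (a * (x * n-1) + y * n) % n        ≡⟨ cong (λ z → (a * (x * n-1) + z) % n) 1+xa≡yn ⟨
  (a * (x * n-1) + (1 + x * a)) % n  ≡⟨ cong (_% n) (regroup a x n-1) ⟩
  (1 + (x * a) * n) % n              ≡⟨ [m+kn]%n≡m%n 1 (x * a) n ⟩
  1 % n                              ∎)
  where
  n = suc n-1
  regroup : ∀ a x m → a * (x * m) + (1 + x * a) ≡ 1 + (x * a) * suc m
  regroup = solve-∀

xor-cancelˡ : ∀ x {y z} → x xor y ≡ x xor z → y ≡ z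
xor-cancelˡ false e = e
xor-cancelˡ true  e = not-injective e

xsum : ℕ → (ℕ → Bool) → Bool
xsum zero    h = false
xsum (suc q) h = h 0 xor xsum q (h ∘ suc)

xsum-cong : ∀ q {g h : ℕ → Bool} → (∀ j → j < q → g j ≡ h j) → xsum q g ≡ xsum q h
xsum-cong zero    g≡h = refl
xsum-cong (suc q) g≡h = cong₂ _xor_ (g≡h 0 z<s) (xsum-cong q (λ j j<q → g≡h (suc j) (s<s j<q)))

xsum-false : ∀ q → xsum q (λ _ → false) ≡ false
xsum-false zero    = refl
xsum-false (suc q) = xsum-false q

xsum-∧ : ∀ q b h → xsum q (λ j → b ∧ h j) ≡ (b ∧ xsum q h)
xsum-∧ zero    b h = sym (∧-zeroʳ b)
xsum-∧ (suc q) b h =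
  trans (cong ((b ∧ h 0) xor_) (xsum-∧ q b (h ∘ suc))) (sym (∧-distribˡ-xor b (h 0) _))

xsum-snoc : ∀ q h → xsum (suc q) h ≡ xsum q h xor h q
xsum-snoc zero    h = xor-comm (h 0) false
xsum-snoc (suc q) h = trans (cong (h 0 xor_) (xsum-snoc q (h ∘ suc))) (sym (xor-assoc (h 0) _ _))

xsum-rotate : ∀ q h → h q ≡ h 0 → xsum q (h ∘ suc) ≡ xsum q h
xsum-rotate q h hq≡h0 = xor-cancelˡ (h 0) (begin
  h 0 xor xsum q (h ∘ suc)  ≡⟨ xsum-snoc q h ⟩
  xsum q h xor h q          ≡⟨ cong (xsum q h xor_) hq≡h0 ⟩
  xsum q h xor h 0          ≡⟨ xor-comm (xsum q h) (h 0) ⟩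
  h 0 xor xsum q h          ∎)

xsum-only-first : ∀ q d .{{_ : NonZero q}} .{{_ : NonZero d}} → xsum q (λ j → j * d ≡ᵇ 0) ≡ true
xsum-only-first (suc q) (suc d) = cong (true xor_) (xsum-false q)

module MultiplesInProgression (N q d : ℕ) .{{N≢0 : NonZero N}} .{{_ : NonZero d}}
                              (N≡q*d : N ≡ q * d) where

  parity : ℕ → Bool
  parity t = xsum q (λ j → (t + j * d) % N ≡ᵇ 0)

  parity-+d : ∀ t → parity (t + d) ≡ parity t
  parity-+d t = trans (xsum-cong q (λ j _ → cong (λ x → x % N ≡ᵇ 0) (+-assoc t d (j * d))))
                      (xsum-rotate q _ (cong (_≡ᵇ 0) wraps))
    where
    wraps : (t + q * d) % N ≡ (t + 0 * d) % N
    wraps = begin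
      (t + q * d) % N  ≡⟨ cong (λ x → (t + x) % N) N≡q*d ⟨
      (t + N) % N      ≡⟨ [m+n]%n≡m%n t N ⟩
      t % N            ≡⟨ cong (_% N) (+-identityʳ t) ⟨
      (t + 0) % N      ∎

  parity-+*d : ∀ t c → parity (t + c * d) ≡ parity t
  parity-+*d t zero    = cong parity (+-identityʳ t)
  parity-+*d t (suc c) = begin
    parity (t + (d + c * d))  ≡⟨ cong parity (xy∙z≈x∙zy t (c * d) d) ⟨
    parity (t + c * d + d)    ≡⟨ parity-+d (t + c * d) ⟩
    parity (t + c * d)        ≡⟨ parity-+*d t c ⟩
    parity t                  ∎

  parity-< : ∀ r → r < d → parity r ≡ (r ≡ᵇ 0)
  parity-< r r<d = trans (xsum-cong q (λ j j<q → cong (_≡ᵇ 0) (m<n⇒m%n≡m (below-N j j<q))))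
                         (only-first-term r)
    where
    below-N : ∀ j → j < q → r + j * d < N
    below-N j j<q =
      <-≤-trans (+-monoˡ-< (j * d) r<d) (≤-trans (*-monoˡ-≤ d j<q) (≤-reflexive (sym N≡q*d)))
    only-first-term : ∀ s → xsum q (λ j → s + j * d ≡ᵇ 0) ≡ (s ≡ᵇ 0)
    only-first-term zero    = xsum-only-first q d {{m*n≢0⇒m≢0 q {{subst NonZero N≡q*d N≢0}}}}
    only-first-term (suc s) = xsum-false q

  parity≡divisible : ∀ t → parity t ≡ (t % d ≡ᵇ 0)
  parity≡divisible t = begin
    parity t                      ≡⟨ cong parity (m≡m%n+[m/n]*n t d) ⟩
    parity (t % d + (t / d) * d)  ≡⟨ parity-+*d (t % d) (t / d) ⟩
    parity (t % d)                ≡⟨ parity-< (t % d) (m%n<n t d) ⟩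
    (t % d ≡ᵇ 0)                  ∎

xsum-window : ∀ d .{{_ : NonZero d}} m → xsum d (λ i → (m + i) % d ≡ᵇ 0) ≡ true
xsum-window d m = begin
  xsum d (λ i → (m + i) % d ≡ᵇ 0)  ≡⟨ xsum-cong d (λ i _ → cong (λ x → (m + x) % d ≡ᵇ 0) (*-identityʳ i)) ⟨
  parity m                         ≡⟨ parity≡divisible m ⟩
  (m % 1 ≡ᵇ 0)                     ≡⟨ cong (_≡ᵇ 0) (n%1≡0 m) ⟩
  true                             ∎
  where open MultiplesInProgression d d 1 (sym (*-identityʳ d))

module _ {n : ℕ} .{{_ : NonZero n}} where

  toℕ-idx : ∀ m → toℕ (idx n m) ≡ m % n
  toℕ-idx m = toℕ-fromℕ< (m%n<n m n)

  toℕ-idx-% : ∀ m → toℕ (idx n m) % n ≡ m % n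
  toℕ-idx-% m = trans (cong (_% n) (toℕ-idx m)) (m%n%n≡m%n m n)

  infixl 10 _‼_

  -- Opaque, so that Y can be inferred from Y ‼ m by unification.
  opaque
    _‼_ : Z2^ n → ℕ → Bool
    Y ‼ m = lookup Y (idx n m)

    ‼-mod : ∀ Y {x y} → x % n ≡ y % n → Y ‼ x ≡ Y ‼ y
    ‼-mod Y e = cong (lookup Y) (fromℕ<-cong _ _ e _ _)

    ‼-ext : ∀ {Y Z} → (∀ m → Y ‼ m ≡ Z ‼ m) → Y ≡ Z
    ‼-ext {Y} {Z} Y≗Z = begin
      Y                    ≡⟨ tabulate∘lookup Y ⟨
      tabulate (lookup Y)  ≡⟨ tabulate-cong pointwise ⟩
      tabulate (lookup Z)  ≡⟨ tabulate∘lookup Z ⟩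
      Z                    ∎
      where
      pointwise : ∀ i → lookup Y i ≡ lookup Z i
      pointwise i = subst (λ j → lookup Y j ≡ lookup Z j) idx-toℕ (Y≗Z (toℕ i))
        where
        idx-toℕ : idx n (toℕ i) ≡ i
        idx-toℕ = toℕ-injective (trans (toℕ-idx (toℕ i)) (m<n⇒m%n≡m (toℕ<n i)))

    ‼-𝟙 : ∀ m → 𝟙 ‼ m ≡ false
    ‼-𝟙 m = lookup-replicate (idx n m) false

    ‼-· : ∀ Y Z m → (Y · Z) ‼ m ≡ (Y ‼ m xor Z ‼ m)
    ‼-· Y Z m = lookup-zipWith _xor_ (idx n m) Y Z

    ‼-C : ∀ Y m → C n Y ‼ m ≡ Y ‼ suc m
    ‼-C Y m = trans (lookup∘tabulate _ (idx n m)) (‼-mod Y (%-congʳ-+ 1 (toℕ-idx-% m)))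

    ‼-δ : ∀ a Y m → δ n a Y ‼ m ≡ Y ‼ (a * m)
    ‼-δ a Y m = trans (lookup∘tabulate _ (idx n m)) (‼-mod Y (%-congʳ-* a (toℕ-idx-% m)))

    ‼-X : ∀ m → X n ‼ m ≡ (m % n ≡ᵇ 0)
    ‼-X m = trans (lookup∘tabulate _ (idx n m)) (cong (_≡ᵇ 0) (toℕ-idx m))

  ‼-+*n : ∀ Y x k → Y ‼ (x + k * n) ≡ Y ‼ x
  ‼-+*n Y x k = ‼-mod Y ([m+kn]%n≡m%n x k n)

  ‼-if : ∀ b Y m → (if b then Y else 𝟙) ‼ m ≡ (b ∧ Y ‼ m)
  ‼-if true  Y m = refl
  ‼-if false Y m = ‼-𝟙 m

  ‼-∏ : ∀ q (G : ℕ → Z2^ n) f m →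
        foldr _·_ 𝟙 (map G (applyUpTo f q)) ‼ m ≡ xsum q (λ j → G (f j) ‼ m)
  ‼-∏ zero    G f m = ‼-𝟙 m
  ‼-∏ (suc q) G f m = trans (‼-· (G (f 0)) _ m) (cong (G (f 0) ‼ m xor_) (‼-∏ q G (f ∘ suc) m))

  ‼-Cpow : ∀ k Y m → Cpow n k Y ‼ m ≡ Y ‼ (k + m)
  ‼-Cpow zero    Y m = refl
  ‼-Cpow (suc k) Y m =
    trans (‼-C (Cpow n k Y) m) (trans (‼-Cpow k Y (suc m)) (cong (Y ‼_) (+-suc k m)))

InGen-if : ∀ {n d} {gen : ℕ → Z2^ n} {Y} b → InGen d gen Y → InGen d gen (if b then Y else 𝟙)
InGen-if true  Y∈ = Y∈
InGen-if false _  = unit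

InGen-∏ : ∀ {n d} {gen : ℕ → Z2^ n} (G : ℕ → Z2^ n) q f →
          (∀ j → j < q → InGen d gen (G (f j))) → InGen d gen (foldr _·_ 𝟙 (map G (applyUpTo f q)))
InGen-∏ G zero    f G∈ = unit
InGen-∏ G (suc q) f G∈ = mul (G∈ 0 z<s) (InGen-∏ G q (f ∘ suc) (λ j j<q → G∈ (suc j) (s<s j<q)))

Periodic : ∀ {n} .{{_ : NonZero n}} → ℕ → Z2^ n → Set
Periodic d Y = ∀ m → Y ‼ (m + d) ≡ Y ‼ m

module _ {n : ℕ} .{{_ : NonZero n}} {d : ℕ} where

  periodic-𝟙 : Periodic d 𝟙
  periodic-𝟙 m = trans (‼-𝟙 (m + d)) (sym (‼-𝟙 m))

  periodic-· : ∀ {Y Z} → Periodic d Y → Periodic d Z → Periodic d (Y · Z)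
  periodic-· {Y} {Z} pY pZ m =
    trans (‼-· Y Z (m + d)) (trans (cong₂ _xor_ (pY m) (pZ m)) (sym (‼-· Y Z m)))

  periodic-+* : ∀ {Y} → Periodic d Y → ∀ x k → Y ‼ (x + k * d) ≡ Y ‼ x
  periodic-+* {Y} pY x zero    = cong (Y ‼_) (+-identityʳ x)
  periodic-+* {Y} pY x (suc k) = begin
    Y ‼ (x + (d + k * d))  ≡⟨ cong (Y ‼_) (xy∙z≈x∙zy x (k * d) d) ⟨
    Y ‼ (x + k * d + d)    ≡⟨ pY (x + k * d) ⟩
    Y ‼ (x + k * d)        ≡⟨ periodic-+* pY x k ⟩
    Y ‼ x                  ∎

  periodic-residue : ∀ .{{_ : NonZero d}} {Y : Z2^ n} {i m} → Periodic d Y → i ≤ d → (m + i) % d ≡ 0 →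
                     Y ‼ (d ∸ i) ≡ Y ‼ m
  periodic-residue {Y} {i} {m} pY i≤d m+i≡0 = begin
    Y ‼ (d ∸ i)          ≡⟨ periodic-+* pY (d ∸ i) c ⟨
    Y ‼ (d ∸ i + c * d)  ≡⟨ cong (Y ‼_) m+d≡ ⟨
    Y ‼ (m + d)          ≡⟨ pY m ⟩
    Y ‼ m                ∎
    where
    c = (m + i) / d
    m+d≡ : m + d ≡ d ∸ i + c * d
    m+d≡ = begin
      m + d                ≡⟨ cong (m +_) (m+[n∸m]≡n i≤d) ⟨
      m + (i + (d ∸ i))    ≡⟨ +-assoc m i (d ∸ i) ⟨
      m + i + (d ∸ i)      ≡⟨ cong (_+ (d ∸ i)) (trans (m≡m%n+[m/n]*n (m + i) d) (cong (_+ c * d) m+i≡0)) ⟩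
      c * d + (d ∸ i)      ≡⟨ +-comm (c * d) (d ∸ i) ⟩
      d ∸ i + c * d        ∎

  periodic-∧-divisible : ∀ .{{_ : NonZero d}} {Y : Z2^ n} {i} → Periodic d Y → i ≤ d → ∀ m →
                         (Y ‼ (d ∸ i) ∧ ((m + i) % d ≡ᵇ 0)) ≡ (Y ‼ m ∧ ((m + i) % d ≡ᵇ 0))
  periodic-∧-divisible {Y} {i} pY i≤d m with (m + i) % d in m+i≡
  ... | zero  = cong (_∧ true) (periodic-residue pY i≤d m+i≡)
  ... | suc _ = trans (∧-zeroʳ _) (sym (∧-zeroʳ _))

AffineReindexing : ∀ {n} .{{_ : NonZero n}} → Z2^ n → Z2^ n → Set
AffineReindexing Y Z = ∃₂ λ a c → ∀ m → Z ‼ m ≡ Y ‼ (a * m + c)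

module _ {n : ℕ} .{{_ : NonZero n}} where

  periodic-reindex : ∀ {d Y Z} → AffineReindexing Y Z → Periodic d Y → Periodic d Z
  periodic-reindex {d} {Y} {Z} (a , c , Z≗Y) pY m = begin
    Z ‼ (m + d)              ≡⟨ Z≗Y (m + d) ⟩
    Y ‼ (a * (m + d) + c)    ≡⟨ cong (Y ‼_) (shift a m c d) ⟩
    Y ‼ (a * m + c + a * d)  ≡⟨ periodic-+* pY (a * m + c) a ⟩
    Y ‼ (a * m + c)          ≡⟨ Z≗Y m ⟨
    Z ‼ m                    ∎
    where
    shift : ∀ a m c d → a * (m + d) + c ≡ a * m + c + a * d
    shift = solve-∀

  C-reindexing : ∀ Y → AffineReindexing Y (C n Y)
  C-reindexing Y = 1 , 1 , λ m →
    trans (‼-C Y m) (cong (Y ‼_) (sym (trans (cong (_+ 1) (*-identityˡ m)) (+-comm m 1))))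

  C⁻¹-reindexing : ∀ Y → AffineReindexing (C n Y) Y
  C⁻¹-reindexing Y = 1 , pred n , λ m → begin
    Y ‼ m                      ≡⟨ ‼-+*n Y m 1 ⟨
    Y ‼ (m + 1 * n)            ≡⟨ cong (λ k → Y ‼ (m + 1 * k)) (suc-pred n) ⟨
    Y ‼ (m + 1 * suc (pred n)) ≡⟨ cong (Y ‼_) (wrap m (pred n)) ⟩
    Y ‼ suc (1 * m + pred n)   ≡⟨ ‼-C Y _ ⟨
    C n Y ‼ (1 * m + pred n)   ∎
    where
    wrap : ∀ m p → m + 1 * suc p ≡ suc (1 * m + p)
    wrap = solve-∀

  δ-reindexing : ∀ a Y → AffineReindexing Y (δ n a Y)
  δ-reindexing a Y = a , 0 , λ m → trans (‼-δ a Y m) (cong (Y ‼_) (sym (+-identityʳ (a * m))))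

  δ⁻¹-reindexing : ∀ {a} → Coprime a n → ∀ Y → AffineReindexing (δ n a Y) Y
  δ⁻¹-reindexing {a} a⊥n Y with modular-inverse a⊥n
  ... | b , ab≡1 = b , 0 , λ m → begin
    Y ‼ m                  ≡⟨ ‼-mod Y (cancels m) ⟨
    Y ‼ (a * (b * m + 0))  ≡⟨ ‼-δ a Y _ ⟨
    δ n a Y ‼ (b * m + 0)  ∎
    where
    regroup : ∀ a b m → a * (b * m + 0) ≡ m * (a * b)
    regroup = solve-∀
    cancels : ∀ m → (a * (b * m + 0)) % n ≡ m % n
    cancels m = begin
      (a * (b * m + 0)) % n  ≡⟨ cong (_% n) (regroup a b m) ⟩
      (m * (a * b)) % n      ≡⟨ %-congʳ-* m ab≡1 ⟩
      (m * 1) % n            ≡⟨ cong (_% n) (*-identityʳ m) ⟩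
      m % n                  ∎

  step-reindexings : ∀ {Y Z} → Step n Y Z → AffineReindexing Y Z × AffineReindexing Z Y
  step-reindexings (stepC Y)          = C-reindexing Y , C⁻¹-reindexing Y
  step-reindexings (stepδ a _ a⊥n Y) = δ-reindexing a Y , δ⁻¹-reindexing a⊥n Y

  periodic-step : ∀ {d Y Z} → Step n Y Z → Periodic d Y ⇔ Periodic d Z
  periodic-step s with step-reindexings s
  ... | Y→Z , Z→Y = mk⇔ (periodic-reindex Y→Z) (periodic-reindex Z→Y)

  periodic-orbit : ∀ {d Y Z} → SameOrbit n Y Z → Periodic d Y ⇔ Periodic d Z
  periodic-orbit {d} = gfold ⇔-isEquivalence (Periodic d) periodic-step

module _ {n : ℕ} .{{_ : NonZero n}} {d q : ℕ} .{{_ : NonZero d}} (n≡q*d : n ≡ q * d) where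

  ‼-A : ∀ i m → A n d q i ‼ m ≡ ((m + i) % d ≡ᵇ 0)
  ‼-A i m = begin
    A n d q i ‼ m                                 ≡⟨ ‼-∏ q (λ j → Cpow n (i + j * d) (X n)) id m ⟩
    xsum q (λ j → Cpow n (i + j * d) (X n) ‼ m)   ≡⟨ xsum-cong q (λ j _ → shifted-X j) ⟩
    parity (m + i)                                ≡⟨ parity≡divisible (m + i) ⟩
    ((m + i) % d ≡ᵇ 0)                            ∎
    where
    open MultiplesInProgression n q d n≡q*d
    shifted-X : ∀ j → Cpow n (i + j * d) (X n) ‼ m ≡ ((m + i + j * d) % n ≡ᵇ 0)
    shifted-X j = trans (‼-Cpow (i + j * d) (X n) m) (trans (‼-X _) (cong (λ x → x % n ≡ᵇ 0)
      (xy∙z≈zx∙y i (j * d) m)))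

  periodic-A : ∀ i → Periodic d (A n d q i)
  periodic-A i m = begin
    A n d q i ‼ (m + d)     ≡⟨ ‼-A i (m + d) ⟩
    ((m + d + i) % d ≡ᵇ 0)  ≡⟨ cong (_≡ᵇ 0) (trans (cong (_% d) (xy∙z≈xz∙y m d i)) ([m+n]%n≡m%n (m + i) d)) ⟩
    ((m + i) % d ≡ᵇ 0)      ≡⟨ ‼-A i m ⟨
    A n d q i ‼ m           ∎

  𝔾⇒periodic : ∀ {Y} → 𝔾 n d q Y → Periodic d Y
  𝔾⇒periodic unit        = periodic-𝟙
  𝔾⇒periodic (gen∈ i _) = periodic-A i
  𝔾⇒periodic (mul y z)   = periodic-· (𝔾⇒periodic y) (𝔾⇒periodic z)

  periodic⇒𝔾 : ∀ {Y : Z2^ n} → Periodic d Y → 𝔾 n d q Y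
  periodic⇒𝔾 {Y} pY =
    subst (𝔾 n d q) (‼-ext reconstruct) (InGen-∏ B d id (λ i i<d → InGen-if (Y ‼ (d ∸ i)) (gen∈ i i<d)))
    where
    B : ℕ → Z2^ n
    B i = if Y ‼ (d ∸ i) then A n d q i else 𝟙
    -- At m only the unique i < d with m + i ≡ 0 (mod d) contributes, with Y ‼ (d ∸ i) = Y ‼ m.
    reconstruct : ∀ m → foldr _·_ 𝟙 (map B (upTo d)) ‼ m ≡ Y ‼ m
    reconstruct m = begin
      foldr _·_ 𝟙 (map B (upTo d)) ‼ m              ≡⟨ ‼-∏ d B id m ⟩
      xsum d (λ i → B i ‼ m)                          ≡⟨ xsum-cong d coefficient ⟩
      xsum d (λ i → Y ‼ m ∧ ((m + i) % d ≡ᵇ 0))       ≡⟨ xsum-∧ d (Y ‼ m) _ ⟩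
      Y ‼ m ∧ xsum d (λ i → (m + i) % d ≡ᵇ 0)         ≡⟨ cong (Y ‼ m ∧_) (xsum-window d m) ⟩
      Y ‼ m ∧ true                                    ≡⟨ ∧-identityʳ _ ⟩
      Y ‼ m                                           ∎
      where
      coefficient : ∀ i → i < d → B i ‼ m ≡ (Y ‼ m ∧ ((m + i) % d ≡ᵇ 0))
      coefficient i i<d = trans (‼-if _ _ m) (trans (cong (Y ‼ (d ∸ i) ∧_) (‼-A i m))
                                (periodic-∧-divisible pY (<⇒≤ i<d) m))

mainTheorem18 : (n : ℕ) → .{{_ : NonZero n}} → (d : ℕ) → .{{_ : NonZero d}} → (d∣n : d ∣ n)
    → UnionOfOrbits n (𝔾 n d (quotient d∣n))
mainTheorem18 n d d∣n Y Z Y~Z Y∈𝔾 =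
  periodic⇒𝔾 {q = q} n≡q*d (Equivalence.to (periodic-orbit Y~Z) (𝔾⇒periodic {q = q} n≡q*d Y∈𝔾))
  where
  q = quotient d∣n
  n≡q*d = _∣_.equality d∣n
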